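{- Let $\mathcal{A}=(A_0,A_1,\mathcal{F})$ with $\mathcal{F}=\mathcal{G}_0\cup\mathcal{G}_1\cup\{h\}$, where $\mathcal{G}_0$ consists of operations on $A_0$, $\mathcal{G}_1$ consists of operations on $A_1$, and $h:A_1\to A_0$ is unary. Suppose that $\mathcal{A}_1=(A_1,\mathcal{G}_1)$ is a Ramsey algebra and that $h$ is a homomorphism from $\mathcal{A}_1$ into $\mathcal{A}_0=(A_0,\mathcal{G}_0)$. Then $\mathcal{A}$ is an $\vec{e}$-Ramsey algebra for each $\vec{e}\in\Omega_0$.
   Context: An algebra is a pair $(\{A_\xi\}_{\xi\in I},\mathcal{F})$ with nonempty, pairwise disjoint phyla and a family $\mathcal{F}$ of operations, each with domain a finite product of phyla and codomain a phylum. An operation "on $A_i$" has all arguments and values in $A_i$. A sort is $\vec{e}\in{}^\omega I$, and $\vec{b}$ is $\vec{e}$-sorted if $\vec{b}(i)\in A_{\vec{e}(i)}$ for all $i$. Orderly terms: $\mathcal{F}_0=\mathcal{F}\cup\{\mathrm{id}_{A_\xi}\}$. $\mathcal{F}_{k+1}$ is $\mathcal{F}_k$ plus all $f$ with $f(\vec{x})=g(h_1(\vec{x}_1),\dots,h_N(\vec{x}_N))$, where $g\in\mathcal{F}$ is $N$-ary, $h_i\in\mathcal{F}_k$, and $\vec{x}_1\ast\cdots\ast\vec{x}_N=\vec{x}$ is the argument list of $f$ (concatenation). $\mathrm{OT}(\mathcal{F})=\bigcup_k\mathcal{F}_k$. $\vec{a}\le_\mathcal{F}\vec{b}$ means: for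 each $j$ there are a finite subsequence $\vec{b}_j$ of $\vec{b}$ and $f_j\in\mathrm{OT}(\mathcal{F})$ with $\vec{a}(j)=f_j(\vec{b}_j)$, and $\vec{b}_0\ast\vec{b}_1\ast\cdots$ is a subsequence of $\vec{b}$. $\mathrm{FR}^{\vec{e}}_\mathcal{F}(\vec{b})=\{\vec{a}(0):\vec{a}\le_\mathcal{F}\vec{b},\ \vec{a}\ \vec{e}\text{ -sorted}\}$. $\vec{e}$-Ramsey algebra: for every $\vec{e}$-sorted $\vec{b}$ and $X\subseteq A_{\vec{e}(0)}$ some $\vec{e}$-sorted $\vec{a}\le_\mathcal{F}\vec{b}$ has $\mathrm{FR}^{\vec{e}}_\mathcal{F}(\vec{a})\subseteq X$ or disjoint from $X$. For a homogeneous algebra $(A,\mathcal{G})$, $\mathrm{FR}_\mathcal{G}(\vec{b})=\{\vec{a}(0):\vec{a}\le_\mathcal{G}\vec{b}\}$. It is a Ramsey algebra if for every $\vec{b}\in{}^\omega A$ and $X\subseteq A$ some $\vec{a}\le_\mathcal{G}\vec{b}$ has $\mathrm{FR}_\mathcal{G}(\vec{a})\subseteq X$ or disjoint from $X$. $\Omega$ is the set of sorts each of whose values is taken infinitely often, and $\Omega_0=\{\vec{e}\in\Omega:\vec{e}(0)=0\}$. Homomorphism: there is an arity-preserving bijection between $\mathcal{G}_1$ and $\mathcal{G}_0$, and for each $n$-ary $F\in\mathcal{G}_1$ with corresponding $f\in\mathcal{G}_0$ and all $a_i\in A_1$, $h(F(a_1,\dots,a_n))=f(h(a_1),\dots,h(a_n))$.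 -}

module Defs where

open import Data.Nat using (ℕ; zero; suc; _<_; _≤_)
open import Data.Fin using (Fin; zero; suc)
open import Data.List using (List; []; _∷_; _++_; map; replicate)
open import Data.List.Relation.Unary.All using (All; []; _∷_)
import Data.List.Relation.Unary.All.Properties as AllP
open import Data.List.Relation.Unary.Linked using (Linked)
open import Data.List.Membership.Propositional using (_∈_)
open import Data.Vec using (Vec; []; _∷_)
import Data.Vec as Vec
open import Data.Product using (Σ; ∃; _×_; _,_)
open import Data.Sum using (_⊎_)
open import Data.Unit using (⊤; tt)
open import Relation.Nullary using (¬_)
open import Relation.Binary.PropositionalEquality using (_≡_; subst; sym)
open import Function.Bundles using (_↔_; Inverse)

-- Phyla are a family  A : I → Set  (distinct
-- indices give distinct, hence "disjoint", types).

record HetOp {I : Set} (A : I → Set) : Set where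
  field
    dom : List I
    cod : I
    fun : All A dom → A cod

module _ {I : Set} (A : I → Set) {Op : Set} (F : Op → HetOp A) where
  open HetOp

  -- Orderly terms: OT σ ξ is an orderly term whose argument list has
  -- sorts σ and whose value lies in phylum ξ.  'var ξ' is id_{A_ξ};
  -- 'app g (t₁ ∷ … ∷ t_N ∷ [])' is  g(h₁(x⃗₁),…,h_N(x⃗_N))  with the
  -- argument list x⃗₁ ∗ ⋯ ∗ x⃗_N.  (g ∈ F itself is app g (var … ∷ …).)
  mutual
    data OT : List I → I → Set where
      var : (ξ : I) → OT (ξ ∷ []) ξ
      app : ∀ {σ} (g : Op) → OTs σ (dom (F g)) → OT σ (cod (F g))

    data OTs : List I → List I → Set where
      [] : OTs [] []
      _∷_ : ∀ {σ σ' ξ τ} → OT σ ξ → OTs σ' τ → OTs (σ ++ σ') (ξ ∷ τ)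

  mutual
    eval : ∀ {σ ξ} → OT σ ξ → All A σ → A ξ
    eval (var ξ) (x ∷ []) = x
    eval (app g ts) xs = fun (F g) (evals ts xs)

    evals : ∀ {σ τ} → OTs σ τ → All A σ → All A τ
    evals [] _ = []
    evals (_∷_ {σ} t ts) xs = eval t (AllP.++⁻ˡ σ xs) ∷ evals ts (AllP.++⁻ʳ σ xs)

  module _ (e : ℕ → I) where
    Seq : Set
    Seq = (i : ℕ) → A (e i)

    pick : Seq → (ι : List ℕ) → All A (map e ι)
    pick b [] = []
    pick b (i ∷ ι) = b i ∷ pick b ι

    -- a⃗ ≤_F b⃗ : a⃗(j) = f_j(b⃗_j), b⃗_j the subsequence of b⃗ at indices
    -- idx j, and the concatenation b⃗_0 ∗ b⃗_1 ∗ ⋯ is a subsequence of b⃗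
    -- (all indices strictly increasing along the concatenation).
    record _≤F_ (a b : Seq) : Set where
      field
        idx        : ℕ → List ℕ
        term       : (j : ℕ) → OT (map e (idx j)) (e j)
        value      : ∀ j → a j ≡ eval (term j) (pick b (idx j))
        increasing : ∀ j → Linked _<_ (idx j)
        separated  : ∀ {j j' x y} → j < j' → x ∈ idx j → y ∈ idx j' → x < y

    FR : Seq → A (e 0) → Set
    FR b x = Σ Seq λ a → (a ≤F b) × (a 0 ≡ x)

    IsERamsey : Set₁
    IsERamsey = (b : Seq) (X : A (e 0) → Set) →
      Σ Seq λ a → (a ≤F b) ×
        ((∀ x → FR a x → X x) ⊎ (∀ x → FR a x → ¬ X x))

record HomOp (A : Set) : Set where
  field
    arity : ℕ
    fun   : Vec A arity → A

allToVec : ∀ {I : Set} {A : I → Set} {ξ : I} n → All A (replicate n ξ) → Vec (A ξ) n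
allToVec zero [] = []
allToVec (suc n) (x ∷ xs) = x ∷ allToVec n xs

onPhylum : ∀ {I : Set} {A : I → Set} (ξ : I) → HomOp (A ξ) → HetOp A
onPhylum ξ g = record
  { dom = replicate (HomOp.arity g) ξ
  ; cod = ξ
  ; fun = λ xs → HomOp.fun g (allToVec _ xs) }

-- Ramsey algebra: the one-phylum case (I = ⊤, the unique sort); then
-- ≤_G, FR_G and the Ramsey property are exactly the homogeneous ones.
IsRamseyAlgebra : (A : Set) {Op : Set} (G : Op → HomOp A) → Set₁
IsRamseyAlgebra A G = IsERamsey (λ (_ : ⊤) → A) (λ g → onPhylum tt (G g)) (λ _ → tt)

IsHomomorphism : {A₁ A₀ Op₁ Op₀ : Set} (G₁ : Op₁ → HomOp A₁) (G₀ : Op₀ → HomOp A₀)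
                 (h : A₁ → A₀) → Set
IsHomomorphism {A₁} {A₀} {Op₁} {Op₀} G₁ G₀ h =
  Σ (Op₁ ↔ Op₀) λ φ →
  Σ (∀ F → HomOp.arity (G₀ (Inverse.to φ F)) ≡ HomOp.arity (G₁ F)) λ ar →
    ∀ F (as : Vec A₁ (HomOp.arity (G₁ F))) →
      h (HomOp.fun (G₁ F) as)
        ≡ HomOp.fun (G₀ (Inverse.to φ F)) (subst (Vec A₀) (sym (ar F)) (Vec.map h as))

Phyla2 : Set → Set → Fin 2 → Set
Phyla2 A₀ A₁ zero = A₀
Phyla2 A₀ A₁ (suc zero) = A₁

data Op2 (Op₀ Op₁ : Set) : Set where
  g0  : Op₀ → Op2 Op₀ Op₁
  g1  : Op₁ → Op2 Op₀ Op₁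
  hOp : Op2 Op₀ Op₁

ops2 : {A₀ A₁ Op₀ Op₁ : Set} (G₀ : Op₀ → HomOp A₀) (G₁ : Op₁ → HomOp A₁)
       (h : A₁ → A₀) → Op2 Op₀ Op₁ → HetOp (Phyla2 A₀ A₁)
ops2 G₀ G₁ h (g0 g) = onPhylum zero (G₀ g)
ops2 G₀ G₁ h (g1 g) = onPhylum (suc zero) (G₁ g)
ops2 G₀ G₁ h hOp = record
  { dom = suc zero ∷ []
  ; cod = zero
  ; fun = λ { (x ∷ []) → h x } }

Ω : (I : Set) → (ℕ → I) → Set
Ω I e = ∀ (ξ : I) (n : ℕ) → ∃ λ m → n ≤ m × e m ≡ ξ

Ω₀ : (ℕ → Fin 2) → Set
Ω₀ e = Ω (Fin 2) e × e 0 ≡ zero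

module Submission where

-- Let e⃗ be a sort in which phylum A₁ occurs infinitely often, b⃗ an
-- e⃗-sorted sequence and X ⊆ A_{e(0)}.  Let c⃗ be the subsequence of b⃗
-- at the positions of sort A₁.  The Ramsey property of (A₁, G₁) applied
-- to c⃗ and to X pulled back along the canonical map  liftv : A₁ → A_{e(0)}
-- (the identity, or h) yields d⃗ ≤ c⃗ with FR(d⃗) homogeneous.  The sequence
-- a⃗ = (liftv_{e(i)} (d i))ᵢ is the required reduction of b⃗:
--   * a⃗ ≤ b⃗, because every G₁-term is a term of the two-phylum algebra,
--     followed by h where the sort of a⃗ is A₀;
--   * FR(a⃗) ⊆ liftv(FR(d⃗)), because, h being a homomorphism, every term
--     of the two-phylum algebra applied to lifts of elements of A₁ is the
--     lift of a G₁-term applied to those elements.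
-- Both facts are instances of one general simulation lemma for orderly
-- terms ('Transport').

open import Defs
open import Data.Nat using (ℕ; zero; suc; _<_; _≤_; _+_; _⊔_; s≤s)
open import Data.Nat.Properties
  using (<-trans; <-≤-trans; ≤-trans; m≤m+n; +-monoʳ-<; m≤m⊔n; m≤n⊔m; m≤n⇒m<n∨m≡n)
open import Data.Fin using (Fin; zero; suc)
open import Data.List using (List; []; _∷_; _++_; map; replicate)
open import Data.List.Properties using (++-identityʳ)
open import Data.List.Relation.Unary.All using (All; []; _∷_)
import Data.List.Relation.Unary.All.Properties as AllP
open import Data.List.Relation.Unary.Linked using (Linked; [-])
import Data.List.Relation.Unary.Linked as Linked
import Data.List.Relation.Unary.Linked.Properties as LinkedP
open import Data.List.Relation.Unary.Any using (here; there)
open import Data.List.Membership.Propositional using (_∈_)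
open import Data.List.Membership.Propositional.Properties using (∈-map⁻)
open import Data.Vec using (Vec)
import Data.Vec as Vec
open import Data.Vec.Properties using (map-id)
open import Data.Product using (Σ; ∃; _×_; _,_; proj₁; proj₂)
open import Data.Sum using (_⊎_; inj₁; inj₂)
open import Data.Unit using (⊤; tt)
open import Relation.Nullary using (¬_)
open import Relation.Binary.PropositionalEquality
open import Function.Base using (_∘′_)
open import Function.Bundles using (_↔_; Inverse)

open HetOp

module _ {I : Set} {A : I → Set} {Op : Set} {F : Op → HetOp A} where

  ++⁻ˡ-++⁺ : ∀ {σ σ'} (xs : All A σ) (ys : All A σ') → AllP.++⁻ˡ σ (AllP.++⁺ xs ys) ≡ xs
  ++⁻ˡ-++⁺ [] ys = refl
  ++⁻ˡ-++⁺ (x ∷ xs) ys = cong (x ∷_) (++⁻ˡ-++⁺ xs ys)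

  ++⁻ʳ-++⁺ : ∀ {σ σ'} (xs : All A σ) (ys : All A σ') → AllP.++⁻ʳ σ (AllP.++⁺ xs ys) ≡ ys
  ++⁻ʳ-++⁺ [] ys = refl
  ++⁻ʳ-++⁺ (x ∷ xs) ys = ++⁻ʳ-++⁺ xs ys

  evals-∷ : ∀ {σ₁ σ₂ ξ τ} (t : OT A F σ₁ ξ) (ts : OTs A F σ₂ τ) (xs : All A σ₁) (ys : All A σ₂) →
    evals A F (t ∷ ts) (AllP.++⁺ xs ys) ≡ eval A F t xs ∷ evals A F ts ys
  evals-∷ t ts xs ys =
    cong₂ _∷_ (cong (eval A F t) (++⁻ˡ-++⁺ xs ys)) (cong (evals A F ts) (++⁻ʳ-++⁺ xs ys))

  eval-subst : ∀ {σ σ' ξ} (p : σ ≡ σ') (t : OT A F σ ξ) {xs : All A σ'} {ys : All A σ} →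
    subst (All A) p ys ≡ xs → eval A F (subst (λ s → OT A F s ξ) p t) xs ≡ eval A F t ys
  eval-subst refl t refl = refl

  subst-∷ : ∀ {ξ σ σ'} (p : σ ≡ σ') (x : A ξ) (xs : All A σ) →
    subst (All A) (cong (ξ ∷_) p) (x ∷ xs) ≡ x ∷ subst (All A) p xs
  subst-∷ refl x xs = refl

  subst-++-identityʳ : ∀ σ (xs : All A (σ ++ [])) → subst (All A) (++-identityʳ σ) xs ≡ AllP.++⁻ˡ σ xs
  subst-++-identityʳ [] [] = refl
  subst-++-identityʳ (ξ ∷ σ) (x ∷ xs) =
    trans (subst-∷ (++-identityʳ σ) x xs) (cong (x ∷_) (subst-++-identityʳ σ xs))

  -- A term with arguments σ as a term with arguments σ ++ [], and back;
  -- needed because the unary operation h produces terms over σ ++ [].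
  padNil : ∀ {σ ξ} → OT A F σ ξ → OT A F (σ ++ []) ξ
  padNil {σ} {ξ} = subst (λ s → OT A F s ξ) (sym (++-identityʳ σ))

  eval-padNil : ∀ {σ ξ} (t : OT A F σ ξ) (xs : All A (σ ++ [])) →
    eval A F (padNil t) xs ≡ eval A F t (AllP.++⁻ˡ σ xs)
  eval-padNil {σ} t xs = eval-subst (sym (++-identityʳ σ)) t
    (trans (cong (subst (All A) (sym (++-identityʳ σ))) (sym (subst-++-identityʳ σ xs)))
           (subst-sym-subst (++-identityʳ σ)))

  unpadNil : ∀ {σ ξ} → OT A F (σ ++ []) ξ → OT A F σ ξ
  unpadNil {σ} {ξ} = subst (λ s → OT A F s ξ) (++-identityʳ σ)

  eval-unpadNil : ∀ {σ ξ} (u : OT A F (σ ++ []) ξ) (xs : All A σ) →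
    eval A F (unpadNil u) xs ≡ eval A F u (AllP.++⁺ xs [])
  eval-unpadNil {σ} u xs = eval-subst (++-identityʳ σ) u
    (trans (subst-++-identityʳ σ (AllP.++⁺ xs [])) (++⁻ˡ-++⁺ xs []))

module Transport {I J : Set} {A : I → Set} {B : J → Set} {OpA OpB : Set}
  (F : OpA → HetOp A) (G : OpB → HetOp B) (κ : I → J) (lift : ∀ ξ → B (κ ξ) → A ξ) where

  _≈lift_ : ∀ {ξ ζ} → A ξ → B ζ → Set
  _≈lift_ {ξ} {ζ} x y = Σ (ζ ≡ κ ξ) λ q → x ≡ lift ξ (subst B q y)

  data Lifts : {σ : List I} {σ' : List J} → All A σ → All B σ' → Set where
    [] : Lifts [] []
    _∷_ : ∀ {ξ ζ σ σ'} {x : A ξ} {y : B ζ} {xs : All A σ} {ys : All B σ'} →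
      x ≈lift y → Lifts xs ys → Lifts (x ∷ xs) (y ∷ ys)

  data SplitLifts (σ₁ σ₂ : List I) : {σ' : List J} → All A (σ₁ ++ σ₂) → All B σ' → Set where
    split : ∀ {σ'₁ σ'₂} {xs₁ : All A σ₁} {xs₂ : All A σ₂} {ys₁ : All B σ'₁} {ys₂ : All B σ'₂} →
      Lifts xs₁ ys₁ → Lifts xs₂ ys₂ → SplitLifts σ₁ σ₂ (AllP.++⁺ xs₁ xs₂) (AllP.++⁺ ys₁ ys₂)

  splitLifts : ∀ σ₁ {σ₂ σ'} {xs : All A (σ₁ ++ σ₂)} {ys : All B σ'} →
    Lifts xs ys → SplitLifts σ₁ σ₂ xs ys
  splitLifts [] r = split [] r
  splitLifts (ξ ∷ σ₁) (x≈y ∷ r) with splitLifts σ₁ r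
  ... | split r₁ r₂ = split (x≈y ∷ r₁) r₂

  data LiftsVec (n : ℕ) (ξ : I) (xs : All A (replicate n ξ)) : {τ : List J} → All B τ → Set where
    liftsVec : {ys : All B (replicate n (κ ξ))} →
      allToVec n xs ≡ Vec.map (lift ξ) (allToVec n ys) → LiftsVec n ξ xs ys

  liftsVec-view : ∀ n {ξ τ} {xs : All A (replicate n ξ)} {ys : All B τ} →
    Lifts xs ys → LiftsVec n ξ xs ys
  liftsVec-view zero [] = liftsVec refl
  liftsVec-view (suc n) ((refl , x≡) ∷ r) with liftsVec-view n r
  ... | liftsVec xs≡ = liftsVec (cong₂ Vec._∷_ x≡ xs≡)

  Simulates : OpA → Set
  Simulates g = ∀ {σ' τ'} {xs : All A (dom (F g))} (ts : OTs B G σ' τ') (ys : All B σ') →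
    Lifts xs (evals B G ts ys) →
    Σ (OT B G σ' (κ (cod (F g)))) λ t → fun (F g) xs ≡ lift (cod (F g)) (eval B G t ys)

  module _ (simulates : ∀ g → Simulates g) where
    mutual
      transport : ∀ {σ σ' ξ} {xs : All A σ} {ys : All B σ'} (t : OT A F σ ξ) → Lifts xs ys →
        Σ (OT B G σ' (κ ξ)) λ t' → eval A F t xs ≡ lift ξ (eval B G t' ys)
      transport (var ξ) ((refl , x≡) ∷ []) = var (κ ξ) , x≡
      transport {ys = ys} (app g ts) r with transports ts r
      ... | τ' , ts' , r' = simulates g ts' ys r'

      transports : ∀ {σ σ' τ} {xs : All A σ} {ys : All B σ'} (ts : OTs A F σ τ) → Lifts xs ys →
        Σ (List J) λ τ' → Σ (OTs B G σ' τ') λ ts' → Lifts (evals A F ts xs) (evals B G ts' ys)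
      transports [] [] = [] , [] , []
      transports (_∷_ {σ₁} t ts) r with splitLifts σ₁ r
      ... | split {xs₁ = xs₁} {xs₂} {ys₁} {ys₂} r₁ r₂ with transport t r₁ | transports ts r₂
      ... | t' , t≡ | τ' , ts' , r' =
        _ ∷ τ' , t' ∷ ts' ,
        subst₂ (λ u v → Lifts u v) (sym (evals-∷ t ts xs₁ xs₂)) (sym (evals-∷ t' ts' ys₁ ys₂))
          ((refl , t≡) ∷ r')

bound : List ℕ → ℕ
bound [] = 0
bound (i ∷ ι) = suc i ⊔ bound ι

∈⇒<bound : ∀ {i ι} → i ∈ ι → i < bound ι
∈⇒<bound {i} {_ ∷ ι} (here refl) = m≤m⊔n (suc i) (bound ι)
∈⇒<bound {i} {j ∷ ι} (there i∈ι) = ≤-trans (∈⇒<bound i∈ι) (m≤n⊔m (suc j) (bound ι))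

StrictlyIncreasing : (ℕ → ℕ) → Set
StrictlyIncreasing p = ∀ {i j} → i < j → p i < p j

module _ {p : ℕ → ℕ} (increasing : StrictlyIncreasing p) where

  linked-map : ∀ {ι} → Linked _<_ ι → Linked _<_ (map p ι)
  linked-map inc = LinkedP.map⁺ (Linked.map increasing inc)

  separated-map : ∀ {ι ι'} → (∀ {x y} → x ∈ ι → y ∈ ι' → x < y) →
    ∀ {x y} → x ∈ map p ι → y ∈ map p ι' → x < y
  separated-map sep x∈ y∈ with ∈-map⁻ p x∈ | ∈-map⁻ p y∈
  ... | _ , x'∈ , refl | _ , y'∈ , refl = increasing (sep x'∈ y'∈)

module Positions {I : Set} (e : ℕ → I) (ξ : I) (often : ∀ n → ∃ λ m → n ≤ m × e m ≡ ξ) where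

  pos : ℕ → ℕ
  pos zero = proj₁ (often 0)
  pos (suc k) = proj₁ (often (suc (pos k)))

  pos-sort : ∀ k → e (pos k) ≡ ξ
  pos-sort zero = proj₂ (proj₂ (often 0))
  pos-sort (suc k) = proj₂ (proj₂ (often (suc (pos k))))

  pos-step : ∀ k → pos k < pos (suc k)
  pos-step k = proj₁ (proj₂ (often (suc (pos k))))

  pos-increasing : StrictlyIncreasing pos
  pos-increasing {i} {suc j} (s≤s i≤j) with m≤n⇒m<n∨m≡n i≤j
  ... | inj₁ i<j = <-trans (pos-increasing i<j) (pos-step j)
  ... | inj₂ refl = pos-step i

-- In a constant sort ξ, the value of a term on an increasing finite
-- subsequence of d⃗ belongs to FR(d⃗): it heads the reduction of d⃗
-- that continues with the tail of d⃗ beyond that subsequence.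

module _ {I : Set} {A : I → Set} {Op : Set} {F : Op → HetOp A} {ξ : I} where

  FR-term : (d : Seq A F (λ _ → ξ)) {ι : List ℕ} → Linked _<_ ι →
    (t : OT A F (map (λ _ → ξ) ι) ξ) → FR A F (λ _ → ξ) d (eval A F t (pick A F (λ _ → ξ) d ι))
  FR-term d {ι} inc t = d' , d'≤d , refl
    where
    N : ℕ
    N = bound ι

    d' : Seq A F (λ _ → ξ)
    d' zero = eval A F t (pick A F (λ _ → ξ) d ι)
    d' (suc j) = d (N + j)

    idx' : ℕ → List ℕ
    idx' zero = ι
    idx' (suc j) = N + j ∷ []

    term' : ∀ j → OT A F (map (λ _ → ξ) (idx' j)) ξ
    term' zero = t
    term' (suc j) = var ξ

    value' : ∀ j → d' j ≡ eval A F (term' j) (pick A F (λ _ → ξ) d (idx' j))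
    value' zero = refl
    value' (suc j) = refl

    increasing' : ∀ j → Linked _<_ (idx' j)
    increasing' zero = inc
    increasing' (suc j) = [-]

    separated' : ∀ {j j' x y} → j < j' → x ∈ idx' j → y ∈ idx' j' → x < y
    separated' {zero} {suc j'} _ x∈ (here refl) = <-≤-trans (∈⇒<bound x∈) (m≤m+n N j')
    separated' {suc j} {suc j'} (s≤s j<j') (here refl) (here refl) = +-monoʳ-< N j<j'

    d'≤d : _≤F_ A F (λ _ → ξ) d' d
    d'≤d = record { idx = idx' ; term = term' ; value = value'
                  ; increasing = increasing' ; separated = separated' }

module TwoPhyla {A₀ A₁ Op₀ Op₁ : Set}
  (G₀ : Op₀ → HomOp A₀) (G₁ : Op₁ → HomOp A₁) (h : A₁ → A₀) where

  P : Fin 2 → Set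
  P = Phyla2 A₀ A₁

  F : Op2 Op₀ Op₁ → HetOp P
  F = ops2 G₀ G₁ h

  P₁ : ⊤ → Set
  P₁ _ = A₁

  F₁ : Op₁ → HetOp P₁
  F₁ g = onPhylum tt (G₁ g)

  Seq₁ : Set
  Seq₁ = Seq P₁ F₁ (λ _ → tt)

  FR₁ : Seq₁ → A₁ → Set
  FR₁ = FR P₁ F₁ (λ _ → tt)

  liftv : ∀ ξ → A₁ → P ξ
  liftv zero y = h y
  liftv (suc zero) y = y

  liftSeq : (e : ℕ → Fin 2) → Seq₁ → Seq P F e
  liftSeq e d i = liftv (e i) (d i)

  -- Every G₁-term is a term of the two-phylum algebra valued in A₁.
  module Embed = Transport F₁ F (λ _ → suc zero) (λ _ y → y)

  embed-simulates : ∀ g → Embed.Simulates g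
  embed-simulates g ts ys r with Embed.liftsVec-view _ r
  ... | Embed.liftsVec xs≡ = app (g1 g) ts , cong (HomOp.fun (G₁ g)) (trans xs≡ (map-id _))

  liftTerm : ∀ {σ} ξ → OT P F σ (suc zero) → OT P F σ ξ
  liftTerm zero t = unpadNil (app hOp (t ∷ []))
  liftTerm (suc zero) t = t

  eval-liftTerm : ∀ {σ} ξ (t : OT P F σ (suc zero)) (xs : All P σ) →
    eval P F (liftTerm ξ t) xs ≡ liftv ξ (eval P F t xs)
  eval-liftTerm zero t xs =
    trans (eval-unpadNil (app hOp (t ∷ [])) xs) (cong (fun (F hOp)) (evals-∷ t [] xs []))
  eval-liftTerm (suc zero) t xs = refl

  liftSeq≤ : (e : ℕ → Fin 2) (b : Seq P F e) {p : ℕ → ℕ} → StrictlyIncreasing p →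
    (sort : ∀ k → e (p k) ≡ suc zero) (d : Seq₁) →
    _≤F_ P₁ F₁ (λ _ → tt) d (λ k → subst P (sort k) (b (p k))) →
    _≤F_ P F e (liftSeq e d) b
  liftSeq≤ e b {p} p-increasing sort d d≤c = record
    { idx = λ j → map p (idx j)
    ; term = λ j → liftTerm (e j) (proj₁ (embedded j))
    ; value = λ j → sym (begin
        eval P F (liftTerm (e j) (proj₁ (embedded j))) (pick P F e b (map p (idx j)))
          ≡⟨ eval-liftTerm (e j) (proj₁ (embedded j)) _ ⟩
        liftv (e j) (eval P F (proj₁ (embedded j)) (pick P F e b (map p (idx j))))
          ≡⟨ cong (liftv (e j)) (sym (proj₂ (embedded j))) ⟩
        liftv (e j) (eval P₁ F₁ (term j) (pick P₁ F₁ (λ _ → tt) c (idx j)))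
          ≡⟨ cong (liftv (e j)) (sym (value j)) ⟩
        liftSeq e d j ∎)
    ; increasing = λ j → linked-map p-increasing (increasing j)
    ; separated = λ j<j' → separated-map p-increasing (separated j<j')
    }
    where
    open _≤F_ d≤c
    open ≡-Reasoning

    c : Seq₁
    c k = subst P (sort k) (b (p k))

    lifts-pick : ∀ ι → Embed.Lifts (pick P₁ F₁ (λ _ → tt) c ι) (pick P F e b (map p ι))
    lifts-pick [] = Embed.[]
    lifts-pick (i ∷ ι) = (sort i , refl) Embed.∷ lifts-pick ι

    embedded : ∀ j → Σ (OT P F (map e (map p (idx j))) (suc zero)) λ t →
      eval P₁ F₁ (term j) (pick P₁ F₁ (λ _ → tt) c (idx j)) ≡ eval P F t (pick P F e b (map p (idx j)))
    embedded j = Embed.transport embed-simulates (term j) (lifts-pick (idx j))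

  -- When h is a homomorphism, every term of the two-phylum algebra on
  -- lifts of elements of A₁ is the lift of a G₁-term on those elements.
  module Translation
    (φ : Op₁ ↔ Op₀)
    (ar : ∀ g → HomOp.arity (G₀ (Inverse.to φ g)) ≡ HomOp.arity (G₁ g))
    (hom : ∀ g (as : Vec A₁ (HomOp.arity (G₁ g))) →
      h (HomOp.fun (G₁ g) as)
        ≡ HomOp.fun (G₀ (Inverse.to φ g)) (subst (Vec A₀) (sym (ar g)) (Vec.map h as)))
    where

    allToVec-subst : ∀ {σ n m} (q : n ≡ m) (ts : OTs P₁ F₁ σ (replicate n tt)) (ys : All P₁ σ) →
      allToVec m (evals P₁ F₁ (subst (λ k → OTs P₁ F₁ σ (replicate k tt)) q ts) ys)
        ≡ subst (Vec A₁) q (allToVec n (evals P₁ F₁ ts ys))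
    allToVec-subst refl ts ys = refl

    map-subst : ∀ {n m} (q : n ≡ m) (v : Vec A₁ n) →
      subst (Vec A₀) (sym q) (Vec.map h (subst (Vec A₁) q v)) ≡ Vec.map h v
    map-subst refl v = refl

    hom-term : ∀ g₁ g₀ → Inverse.to φ g₁ ≡ g₀ → ∀ {σ}
      (ts : OTs P₁ F₁ σ (replicate (HomOp.arity (G₀ g₀)) tt)) (ys : All P₁ σ) →
      Σ (OT P₁ F₁ σ tt) λ t →
        HomOp.fun (G₀ g₀) (Vec.map h (allToVec _ (evals P₁ F₁ ts ys))) ≡ h (eval P₁ F₁ t ys)
    hom-term g₁ ._ refl {σ} ts ys = app g₁ ts₁ , sym (begin
        h (HomOp.fun (G₁ g₁) (allToVec _ (evals P₁ F₁ ts₁ ys)))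
          ≡⟨ cong (h ∘′ HomOp.fun (G₁ g₁)) (allToVec-subst (ar g₁) ts ys) ⟩
        h (HomOp.fun (G₁ g₁) (subst (Vec A₁) (ar g₁) v))
          ≡⟨ hom g₁ _ ⟩
        HomOp.fun (G₀ (Inverse.to φ g₁)) (subst (Vec A₀) (sym (ar g₁)) (Vec.map h (subst (Vec A₁) (ar g₁) v)))
          ≡⟨ cong (HomOp.fun (G₀ (Inverse.to φ g₁))) (map-subst (ar g₁) v) ⟩
        HomOp.fun (G₀ (Inverse.to φ g₁)) (Vec.map h v) ∎)
      where
      open ≡-Reasoning
      ts₁ : OTs P₁ F₁ σ (replicate (HomOp.arity (G₁ g₁)) tt)
      ts₁ = subst (λ k → OTs P₁ F₁ σ (replicate k tt)) (ar g₁) ts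
      v : Vec A₁ (HomOp.arity (G₀ (Inverse.to φ g₁)))
      v = allToVec _ (evals P₁ F₁ ts ys)

    module Translate = Transport F F₁ (λ _ → tt) liftv

    translate-simulates : ∀ g → Translate.Simulates g
    translate-simulates (g0 g) ts ys r with Translate.liftsVec-view _ r
    ... | Translate.liftsVec xs≡ with hom-term (Inverse.from φ g) g (Inverse.strictlyInverseˡ φ g) ts ys
    ... | t , t≡ = t , trans (cong (HomOp.fun (G₀ g)) xs≡) t≡
    translate-simulates (g1 g) ts ys r with Translate.liftsVec-view _ r
    ... | Translate.liftsVec xs≡ = app g ts , cong (HomOp.fun (G₁ g)) (trans xs≡ (map-id _))
    translate-simulates hOp (t ∷ []) ys ((refl , x≡) Translate.∷ Translate.[]) =
      padNil t , cong h (trans x≡ (sym (eval-padNil t ys)))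

    FR-liftSeq : (e : ℕ → Fin 2) (d : Seq₁) {x : P (e 0)} → FR P F e (liftSeq e d) x →
      Σ A₁ λ y → FR₁ d y × x ≡ liftv (e 0) y
    FR-liftSeq e d (a , a≤ , refl) =
      let (t , t≡) = translated in
      eval P₁ F₁ t (pick P₁ F₁ (λ _ → tt) d (idx 0)) , FR-term d (increasing 0) t , trans (value 0) t≡
      where
      open _≤F_ a≤

      lifts-pick : ∀ ι → Translate.Lifts (pick P F e (liftSeq e d) ι) (pick P₁ F₁ (λ _ → tt) d ι)
      lifts-pick [] = Translate.[]
      lifts-pick (i ∷ ι) = (refl , refl) Translate.∷ lifts-pick ι

      translated : Σ (OT P₁ F₁ (map (λ _ → tt) (idx 0)) tt) λ t →
        eval P F (term 0) (pick P F e (liftSeq e d) (idx 0))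
          ≡ liftv (e 0) (eval P₁ F₁ t (pick P₁ F₁ (λ _ → tt) d (idx 0)))
      translated = Translate.transport translate-simulates (term 0) (lifts-pick (idx 0))

    homogeneous-liftSeq : (e : ℕ → Fin 2) (d : Seq₁) (X : P (e 0) → Set) →
      (∀ y → FR₁ d y → X (liftv (e 0) y)) ⊎ (∀ y → FR₁ d y → ¬ X (liftv (e 0) y)) →
      (∀ x → FR P F e (liftSeq e d) x → X x) ⊎ (∀ x → FR P F e (liftSeq e d) x → ¬ X x)
    homogeneous-liftSeq e d X (inj₁ inside) = inj₁ λ x x∈ →
      let (y , y∈ , x≡) = FR-liftSeq e d x∈ in subst X (sym x≡) (inside y y∈)
    homogeneous-liftSeq e d X (inj₂ outside) = inj₂ λ x x∈ →
      let (y , y∈ , x≡) = FR-liftSeq e d x∈ in outside y y∈ ∘′ subst X x≡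

mainTheorem7 : {A₀ A₁ Op₀ Op₁ : Set}
    (G₀ : Op₀ → HomOp A₀) (G₁ : Op₁ → HomOp A₁) (h : A₁ → A₀) →
    A₀ → A₁ →
    IsRamseyAlgebra A₁ G₁ →
    IsHomomorphism G₁ G₀ h →
    (e : ℕ → Fin 2) → Ω₀ e →
    IsERamsey (Phyla2 A₀ A₁) (ops2 G₀ G₁ h) e
mainTheorem7 G₀ G₁ h _ _ ramsey (φ , ar , hom) e (ω , _) b X =
  let (d , d≤c , homogeneous) = ramsey c (X ∘′ liftv (e 0)) in
  liftSeq e d , liftSeq≤ e b pos-increasing pos-sort d d≤c , homogeneous-liftSeq e d X homogeneous
  where
  open TwoPhyla G₀ G₁ h
  open Translation φ ar hom
  open Positions e (suc zero) (ω (suc zero))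

  c : Seq₁
  c k = subst P (pos-sort k) (b (pos k))
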